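{- Let $\lambda=(\lambda_1,\lambda_2,\dots,\lambda_r)$ be a partition of $n$ with $r$ parts. Then, in the ring of symmetric functions in the variables $x_1,x_2,\dots$, $$\sum_{\tilde{\lambda}\in Ev(\lambda)} (-1)^{\ell(\tilde{\lambda})}\, p_{\tilde{\lambda}} \;=\; 2^r \prod_{i=1}^{r} m_{\lambda_i\lambda_i},$$ where the sum is over the multiset $Ev(\lambda)$, counted with multiplicity.
   Context: For a partition $\lambda=(\lambda_1,\dots,\lambda_r)$, $Ev(\lambda)$ is the multiset of $2^{r}$ partitions obtained as follows: for each of the $2^r$ choices, independently for each index $i=1,\dots,r$, replace the part $\lambda_i$ either by the single part $2\lambda_i$ (doubling) or by the two parts $\lambda_i,\lambda_i$ (two copies), and rewrite the result in decreasing order. Repeated parts in $\lambda$ are treated as different indices, so the same partition may occur several times in $Ev(\lambda)$. Each element of $Ev(\lambda)$ is a partition of $2n$. Here $\ell(\mu)$ is the number of parts of a partition $\mu$. The power sum symmetric functions are $p_k=\sum_i x_i^k$ and $p_\mu=p_{\mu_1}p_{\mu_2}\cdots$. For a partition $\tau$, $m_\tau$ is the monomial symmetric function $\sum_\alpha x^\alpha$, summed over all distinct permutations $\alpha$ of the entries of $\tau$. In particular $m_{aa}=\sum_{i<j} x_i^a x_j^a$ for a positive integer $a$. -}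

module Defs where

open import Level using (Level)
open import Data.Nat as ℕ using (ℕ; zero; suc; _≤_; _≥_; _≤?_)
open import Data.List using (List; []; _∷_; [_]; concatMap; length)
open import Data.Nat.ListAction using (sum)
open import Data.List.Relation.Unary.All using (All)
open import Data.List.Relation.Unary.Linked using (Linked)
open import Data.Vec using (Vec; []; _∷_)
open import Data.Product using (_×_)
open import Relation.Nullary using (yes; no)
open import Relation.Binary.PropositionalEquality using (_≡_)
open import Algebra.Bundles using (CommutativeRing)

IsPartition : ℕ → List ℕ → Set
IsPartition n λs = All (1 ≤_) λs × Linked _≥_ λs × sum λs ≡ n

insertDesc : ℕ → List ℕ → List ℕ
insertDesc a [] = a ∷ []
insertDesc a (b ∷ bs) with b ≤? a
... | yes _ = a ∷ b ∷ bs
... | no  _ = b ∷ insertDesc a bs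

-- Ev(λ) as a list (multiset) of 2^r partitions: each part a is replaced
-- either by the single part 2a or by the two parts a, a; result sorted
-- in decreasing order.
Ev : List ℕ → List (List ℕ)
Ev [] = [] ∷ []
Ev (a ∷ as) = concatMap (λ μ → insertDesc (2 ℕ.* a) μ ∷ insertDesc a (insertDesc a μ) ∷ []) (Ev as)

-- Symmetric functions evaluated at finitely many variables x₁,…,x_N in a
-- commutative ring R.
module Sym {c ℓ : Level} (R : CommutativeRing c ℓ) where
  open CommutativeRing R

  pow : Carrier → ℕ → Carrier
  pow x zero = 1#
  pow x (suc k) = x * pow x k

  p : ℕ → ∀ {N} → Vec Carrier N → Carrier
  p k [] = 0#
  p k (x ∷ xs) = pow x k + p k xs

  pμ : List ℕ → ∀ {N} → Vec Carrier N → Carrier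
  pμ [] xs = 1#
  pμ (k ∷ ks) xs = p k xs * pμ ks xs

  -- monomial m_{aa} = Σ_{i<j} x_i^a x_j^a
  maa : ℕ → ∀ {N} → Vec Carrier N → Carrier
  maa a [] = 0#
  maa a (x ∷ xs) = pow x a * p a xs + maa a xs

  signedSum : List (List ℕ) → ∀ {N} → Vec Carrier N → Carrier
  signedSum [] xs = 0#
  signedSum (μ ∷ μs) xs = pow (- 1#) (length μ) * pμ μ xs + signedSum μs xs

  prodMaa : List ℕ → ∀ {N} → Vec Carrier N → Carrier
  prodMaa [] xs = 1#
  prodMaa (a ∷ as) xs = maa a xs * prodMaa as xs

-- Expanding p_a² = Σᵢ xᵢ^{2a} + 2 Σ_{i<j} xᵢ^a xⱼ^a gives p_a² − p_{2a} = 2 m_{aa}.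
-- In Ev(λ) the two choices for a part a turn a signed term (−1)^ℓ(μ) p_μ into
-- −p_{2a} (−1)^ℓ(μ) p_μ and p_a² (−1)^ℓ(μ) p_μ, which together contribute
-- 2 m_{aa} (−1)^ℓ(μ) p_μ; induction on the number of parts gives 2^r Πᵢ m_{λᵢλᵢ}.
-- The identity holds for every list of naturals.
module Submission where

open import Defs
open import Level using (Level)
open import Data.Nat using (ℕ)
open import Data.List using (List; length)
open import Data.Vec using (Vec)
open import Algebra.Bundles using (CommutativeRing)

open import Data.Nat as ℕ using (zero; suc; _≤?_)
import Data.Nat.Properties as ℕₚ
open import Data.List using ([]; _∷_; _++_; concatMap)
open import Data.Vec using ([]; _∷_)
open import Relation.Nullary using (yes; no)
open import Relation.Binary.PropositionalEquality as ≡ using (_≡_)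
import Algebra.Properties.Ring as RingProperties
import Algebra.Properties.Group as GroupProperties
import Algebra.Properties.CommutativeSemigroup as CommutativeSemigroupProperties
import Algebra.Solver.Ring.NaturalCoefficients.Default as NaturalCoefficientsSolver
import Relation.Binary.Reasoning.Setoid as SetoidReasoning

length-insertDesc : ∀ a μ → length (insertDesc a μ) ≡ suc (length μ)
length-insertDesc a [] = ≡.refl
length-insertDesc a (b ∷ bs) with b ≤? a
... | yes _ = ≡.refl
... | no  _ = ≡.cong suc (length-insertDesc a bs)

doubleOrCopy : ℕ → List ℕ → List (List ℕ)
doubleOrCopy a μ = insertDesc (2 ℕ.* a) μ ∷ insertDesc a (insertDesc a μ) ∷ []

module SymmetricFunctions {c ℓ : Level} (R : CommutativeRing c ℓ) where
  open CommutativeRing R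
  open Sym R
  open RingProperties ring using (-1*x≈-x; -‿involutive; -‿distribˡ-*; -‿distribʳ-*)
  open GroupProperties +-group using (\\-leftDividesʳ)
  open CommutativeSemigroupProperties *-commutativeSemigroup using (x∙yz≈y∙xz; interchange)
  open SetoidReasoning setoid

  pow-+ : ∀ x m n → pow x (m ℕ.+ n) ≈ pow x m * pow x n
  pow-+ x zero    n = sym (*-identityˡ _)
  pow-+ x (suc m) n = trans (*-congˡ (pow-+ x m n)) (sym (*-assoc x _ _))

  pow-double : ∀ x a → pow x (2 ℕ.* a) ≈ pow x a * pow x a
  pow-double x a = trans (pow-+ x a (a ℕ.+ 0)) (*-congˡ (reflexive (≡.cong (pow x) (ℕₚ.+-identityʳ a))))

  two*x≈x+x : ∀ x → (1# + 1#) * x ≈ x + x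
  two*x≈x+x x = trans (distribʳ x 1# 1#) (+-cong (*-identityˡ x) (*-identityˡ x))

  p-square : ∀ a {N} (x : Vec Carrier N) → p a x * p a x ≈ p (2 ℕ.* a) x + (maa a x + maa a x)
  p-square a []       = trans (zeroˡ 0#) (sym (trans (+-identityˡ _) (+-identityˡ 0#)))
  p-square a (y ∷ xs) = begin
    (Y + Q) * (Y + Q)                        ≈⟨ square-expand Y Q ⟩
    Y * Y + Q * Q + (Y * Q + Y * Q)          ≈⟨ +-congʳ (+-congˡ (p-square a xs)) ⟩
    Y * Y + (Q₂ + (M + M)) + (Y * Q + Y * Q) ≈⟨ regroup Y Q Q₂ M ⟩
    Y * Y + Q₂ + ((Y * Q + M) + (Y * Q + M)) ≈⟨ +-congʳ (+-congʳ (sym (pow-double y a))) ⟩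
    pow y (2 ℕ.* a) + Q₂ + ((Y * Q + M) + (Y * Q + M)) ∎
    where
    Y = pow y a
    Q = p a xs
    Q₂ = p (2 ℕ.* a) xs
    M = maa a xs
    open NaturalCoefficientsSolver commutativeSemiring
    square-expand : ∀ y q → (y + q) * (y + q) ≈ y * y + q * q + (y * q + y * q)
    square-expand = solve 2 (λ y q → (y :+ q) :* (y :+ q) := y :* y :+ q :* q :+ (y :* q :+ y :* q)) refl
    regroup : ∀ y q q₂ m → y * y + (q₂ + (m + m)) + (y * q + y * q) ≈ y * y + q₂ + ((y * q + m) + (y * q + m))
    regroup = solve 4 (λ y q q₂ m → y :* y :+ (q₂ :+ (m :+ m)) :+ (y :* q :+ y :* q)
                                    := y :* y :+ q₂ :+ ((y :* q :+ m) :+ (y :* q :+ m))) refl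

  pμ-insertDesc : ∀ a μ {N} (x : Vec Carrier N) → pμ (insertDesc a μ) x ≈ p a x * pμ μ x
  pμ-insertDesc a []       x = refl
  pμ-insertDesc a (b ∷ bs) x with b ≤? a
  ... | yes _ = refl
  ... | no  _ = trans (*-congˡ (pμ-insertDesc a bs x)) (x∙yz≈y∙xz _ _ _)

  signedTerm : List ℕ → ∀ {N} → Vec Carrier N → Carrier
  signedTerm μ x = pow (- 1#) (length μ) * pμ μ x

  signedTerm-insertDesc : ∀ a μ {N} (x : Vec Carrier N) →
    signedTerm (insertDesc a μ) x ≈ - (p a x * signedTerm μ x)
  signedTerm-insertDesc a μ x = begin
    pow (- 1#) (length (insertDesc a μ)) * pμ (insertDesc a μ) x
      ≈⟨ *-cong (reflexive (≡.cong (pow (- 1#)) (length-insertDesc a μ))) (pμ-insertDesc a μ x) ⟩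
    (- 1# * e) * (p a x * pμ μ x) ≈⟨ *-congʳ (-1*x≈-x e) ⟩
    - e * (p a x * pμ μ x)        ≈⟨ -‿distribˡ-* e _ ⟨
    - (e * (p a x * pμ μ x))      ≈⟨ -‿cong (x∙yz≈y∙xz e _ _) ⟩
    - (p a x * signedTerm μ x)    ∎
    where e = pow (- 1#) (length μ)

  signedSum-++ : ∀ μs νs {N} (x : Vec Carrier N) → signedSum (μs ++ νs) x ≈ signedSum μs x + signedSum νs x
  signedSum-++ []       νs x = sym (+-identityˡ _)
  signedSum-++ (μ ∷ μs) νs x = trans (+-congˡ (signedSum-++ μs νs x)) (sym (+-assoc _ _ _))

  signedSum-concatMap : ∀ (f : List ℕ → List (List ℕ)) (k : Carrier) {N} (x : Vec Carrier N) →
    (∀ μ → signedSum (f μ) x ≈ k * signedTerm μ x) →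
    ∀ μs → signedSum (concatMap f μs) x ≈ k * signedSum μs x
  signedSum-concatMap f k x hf []       = sym (zeroʳ k)
  signedSum-concatMap f k x hf (μ ∷ μs) = begin
    signedSum (f μ ++ concatMap f μs) x                ≈⟨ signedSum-++ (f μ) _ x ⟩
    signedSum (f μ) x + signedSum (concatMap f μs) x   ≈⟨ +-cong (hf μ) (signedSum-concatMap f k x hf μs) ⟩
    k * signedTerm μ x + k * signedSum μs x            ≈⟨ distribˡ k _ _ ⟨
    k * signedSum (μ ∷ μs) x                           ∎

  signedSum-doubleOrCopy : ∀ a μ {N} (x : Vec Carrier N) →
    signedSum (doubleOrCopy a μ) x ≈ (maa a x + maa a x) * signedTerm μ x
  signedSum-doubleOrCopy a μ x = begin
    signedTerm (insertDesc (2 ℕ.* a) μ) x + (signedTerm (insertDesc a (insertDesc a μ)) x + 0#)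
      ≈⟨ +-cong (signedTerm-insertDesc _ μ x) (trans (+-identityʳ _) copies) ⟩
    - (Q₂ * t) + Q * (Q * t)   ≈⟨ +-congˡ (*-assoc Q Q t) ⟨
    - (Q₂ * t) + Q * Q * t     ≈⟨ +-congˡ (*-congʳ (p-square a x)) ⟩
    - (Q₂ * t) + (Q₂ + MM) * t ≈⟨ +-congˡ (distribʳ t Q₂ MM) ⟩
    - (Q₂ * t) + (Q₂ * t + MM * t) ≈⟨ \\-leftDividesʳ (Q₂ * t) (MM * t) ⟩
    MM * t ∎
    where
    Q = p a x
    Q₂ = p (2 ℕ.* a) x
    MM = maa a x + maa a x
    t = signedTerm μ x
    copies : signedTerm (insertDesc a (insertDesc a μ)) x ≈ Q * (Q * t)
    copies = begin
      signedTerm (insertDesc a (insertDesc a μ)) x ≈⟨ signedTerm-insertDesc a (insertDesc a μ) x ⟩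
      - (Q * signedTerm (insertDesc a μ) x)        ≈⟨ -‿cong (*-congˡ (signedTerm-insertDesc a μ x)) ⟩
      - (Q * - (Q * t))                            ≈⟨ -‿cong (-‿distribʳ-* Q _) ⟨
      - - (Q * (Q * t))                            ≈⟨ -‿involutive _ ⟩
      Q * (Q * t)                                  ∎

  signedSum-Ev : ∀ λs {N} (x : Vec Carrier N) → signedSum (Ev λs) x ≈ pow (1# + 1#) (length λs) * prodMaa λs x
  signedSum-Ev []       x = trans (+-identityʳ _) (trans (*-identityˡ 1#) (sym (*-identityˡ 1#)))
  signedSum-Ev (a ∷ as) x = begin
    signedSum (concatMap (doubleOrCopy a) (Ev as)) x
      ≈⟨ signedSum-concatMap (doubleOrCopy a) _ x (λ μ → signedSum-doubleOrCopy a μ x) (Ev as) ⟩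
    (maa a x + maa a x) * signedSum (Ev as) x
      ≈⟨ *-cong (sym (two*x≈x+x _)) (signedSum-Ev as x) ⟩
    ((1# + 1#) * maa a x) * (pow (1# + 1#) (length as) * prodMaa as x)
      ≈⟨ interchange _ _ _ _ ⟩
    pow (1# + 1#) (length (a ∷ as)) * prodMaa (a ∷ as) x ∎

theorem2p1 : ∀ {c ℓ : Level} (R : CommutativeRing c ℓ) (n : ℕ) (λs : List ℕ) →
    IsPartition n λs →
    (N : ℕ) (x : Vec (CommutativeRing.Carrier R) N) →
    let open CommutativeRing R
        open Sym R
    in signedSum (Ev λs) x ≈ pow (1# + 1#) (length λs) * prodMaa λs x
theorem2p1 R n λs _ N x = SymmetricFunctions.signedSum-Ev R λs x
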